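{- Let $G$ be a graph that contains no induced subgraph isomorphic to $C_5$ and no induced subgraph isomorphic to the bull. If $G$ contains an anchor (as an induced subgraph), then $G$ has a homogeneous set.
   Context: All graphs are finite and simple. The bull is the graph consisting of a triangle together with two disjoint pendant edges (vertices $a,b,c,d,e$ with edges $ab,bc,ca,ad,be$ only). A set $A$ is complete (resp. anticomplete) to a disjoint set $B$ if every vertex of $A$ is adjacent (resp. non-adjacent) to every vertex of $B$. A path $p_1-\dots-p_k$ is a sequence of distinct vertices with $p_i$ adjacent to $p_j$ iff $|i-j|=1$. A six-vertex graph is an anchor if it consists of a 4-vertex induced path $P$, a vertex $c$ complete to $V(P)$, and a vertex $a$ anticomplete to $V(P)$ (the pair $a,c$ may be adjacent or not). A set $X\subseteq V(G)$ is a homogeneous set if $1<|X|<|V(G)|$ and every vertex of $V(G)\setminus X$ is either complete or anticomplete to $X$. -}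

module Defs where

open import Data.Nat using (ℕ; _<_)
open import Data.Fin using (Fin; zero; suc)
open import Data.Bool using (Bool; true; false; _∨_)
open import Data.Bool.Properties using (∨-comm)
open import Data.Sum using (_⊎_)
open import Relation.Binary.PropositionalEquality using (_≡_; refl)
open import Data.Fin.Subset using (Subset; _∈_; _∉_; ∣_∣)

record Graph (n : ℕ) : Set where
  field
    adj    : Fin n → Fin n → Bool
    sym    : ∀ u v → adj u v ≡ adj v u
    irrefl : ∀ v → adj v v ≡ false
open Graph public

fromEdges : {k : ℕ} (e : Fin k → Fin k → Bool) → (∀ v → e v v ≡ false) → Graph k
fromEdges e loopless = record
  { adj = λ u v → e u v ∨ e v u
  ; sym = λ u v → ∨-comm (e u v) (e v u)
  ; irrefl = λ v → irr v }
  where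
  irr : ∀ v → (e v v ∨ e v v) ≡ false
  irr v rewrite loopless v = refl

record InducedEmbedding {k n : ℕ} (H : Graph k) (G : Graph n) : Set where
  field
    map       : Fin k → Fin n
    injective : ∀ i j → map i ≡ map j → i ≡ j
    preserves : ∀ i j → adj G (map i) (map j) ≡ adj H i j
open InducedEmbedding public


c5e : Fin 5 → Fin 5 → Bool
c5e zero (suc zero) = true
c5e (suc zero) (suc (suc zero)) = true
c5e (suc (suc zero)) (suc (suc (suc zero))) = true
c5e (suc (suc (suc zero))) (suc (suc (suc (suc zero)))) = true
c5e (suc (suc (suc (suc zero)))) zero = true
c5e _ _ = false

c5loop : ∀ v → c5e v v ≡ false
c5loop zero = refl
c5loop (suc zero) = refl
c5loop (suc (suc zero)) = refl
c5loop (suc (suc (suc zero))) = refl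
c5loop (suc (suc (suc (suc zero)))) = refl

C5 : Graph 5
C5 = fromEdges c5e c5loop

bulle : Fin 5 → Fin 5 → Bool
bulle zero (suc zero) = true
bulle (suc zero) (suc (suc zero)) = true
bulle (suc (suc zero)) zero = true
bulle zero (suc (suc (suc zero))) = true
bulle (suc zero) (suc (suc (suc (suc zero)))) = true
bulle _ _ = false

bullloop : ∀ v → bulle v v ≡ false
bullloop zero = refl
bullloop (suc zero) = refl
bullloop (suc (suc zero)) = refl
bullloop (suc (suc (suc zero))) = refl
bullloop (suc (suc (suc (suc zero)))) = refl

Bull : Graph 5
Bull = fromEdges bulle bullloop

-- Anchor: path p1-p2-p3-p4 = 0-1-2-3, c = 4 complete to {0,1,2,3},
-- a = 5 anticomplete to {0,1,2,3}; the pair a,c is adjacent iff b = true.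
anchore : Bool → Fin 6 → Fin 6 → Bool
anchore b zero (suc zero) = true
anchore b (suc zero) (suc (suc zero)) = true
anchore b (suc (suc zero)) (suc (suc (suc zero))) = true
anchore b zero (suc (suc (suc (suc zero)))) = true
anchore b (suc zero) (suc (suc (suc (suc zero)))) = true
anchore b (suc (suc zero)) (suc (suc (suc (suc zero)))) = true
anchore b (suc (suc (suc zero))) (suc (suc (suc (suc zero)))) = true
anchore b (suc (suc (suc (suc zero)))) (suc (suc (suc (suc (suc zero))))) = b
anchore b _ _ = false

anchorloop : ∀ b v → anchore b v v ≡ false
anchorloop b zero = refl
anchorloop b (suc zero) = refl
anchorloop b (suc (suc zero)) = refl
anchorloop b (suc (suc (suc zero))) = refl
anchorloop b (suc (suc (suc (suc zero)))) = refl
anchorloop b (suc (suc (suc (suc (suc zero))))) = refl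

Anchor : Bool → Graph 6
Anchor b = fromEdges (anchore b) (anchorloop b)

ContainsAnchor : {n : ℕ} → Graph n → Set
ContainsAnchor G = InducedEmbedding (Anchor true) G ⊎ InducedEmbedding (Anchor false) G

record Homogeneous {n : ℕ} (G : Graph n) (X : Subset n) : Set where
  field
    lower : 1 < ∣ X ∣
    upper : ∣ X ∣ < n
    uniform : ∀ v → v ∉ X →
      (∀ x → x ∈ X → adj G v x ≡ true) ⊎ (∀ x → x ∈ X → adj G v x ≡ false)

-- Let P be the induced four-vertex path of the anchor, C the vertices complete and A the
-- vertices anticomplete to V(P); call c ∈ C with a neighbour in A a C⁺-vertex and a ∈ A
-- with a non-neighbour in C an A⁻-vertex. Excluding bulls and C5 by a case analysis on
-- how a vertex sees P shows that every vertex mixed on P is adjacent to all of C⁺ and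
-- non-adjacent to all of A⁻. From this, further bulls show that the property "C⁺ is
-- complete and A⁻ anticomplete to S, and S misses A⁻" survives adding to S any vertex
-- with both a neighbour and a non-neighbour in S. Start from an edge of P and add such
-- vertices while possible: the result is homogeneous, and it is not all of V(G), since
-- the anchor's c is a C⁺-vertex or its a is an A⁻-vertex, according to whether ac is an edge.
module Submission where

open import Defs
open import Data.Nat using (ℕ; zero; suc; _+_; _≤_; _<_)
open import Data.Nat.Properties using (<⇒≱; ≤-trans; <-≤-trans; <⇒≤; ≤-reflexive; +-suc; +-monoˡ-≤; +-identityʳ; m≤n+m)
open import Data.Product using (Σ; ∃; ∃₂; _,_; _×_; proj₂)
open import Data.Sum using (_⊎_; inj₁; inj₂)
open import Data.Bool using (Bool; true; false)
open import Data.Bool.Properties using (¬-not) renaming (_≟_ to _≟ᵇ_)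
open import Data.Empty using (⊥; ⊥-elim)
open import Data.Fin using (Fin; zero; suc; _↑ˡ_)
open import Data.Fin.Properties using (_≟_; all?; any?; ↑ˡ-injective)
open import Data.Fin.Subset using (Subset; _∈_; _∉_; ∣_∣; _∪_; ⁅_⁆)
open import Data.Fin.Subset.Properties using (_∈?_; x∈⁅x⁆; x∈⁅y⁆⇒x≡y; p⊆p∪q; q⊆p∪q; x∈p∪q⁻; p⊂q⇒∣p∣<∣q∣; ∣⊤∣≡n; ∣⁅x⁆∣≡1; ∈⊤)
open import Data.Vec using (_∷_; []; lookup)
open import Relation.Nullary using (¬_; Dec; yes; no; ¬?)
open import Relation.Nullary.Decidable using (from-yes; _→-dec_; _×-dec_; _⊎-dec_)
open import Relation.Binary.PropositionalEquality using (_≡_; _≢_; refl; trans; cong; subst; module ≡-Reasoning)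
  renaming (sym to ≡-sym)

pattern 0F = zero
pattern 1F = suc zero
pattern 2F = suc (suc zero)
pattern 3F = suc (suc (suc zero))
pattern 4F = suc (suc (suc (suc zero)))
pattern 5F = suc (suc (suc (suc (suc zero))))

module Adjacency {n : ℕ} (G : Graph n) where

  infix 4 _~_ _≁_
  _~_ _≁_ : Fin n → Fin n → Set
  u ~ v = adj G u v ≡ true
  u ≁ v = adj G u v ≡ false

  adj-sym : ∀ {u v b} → adj G u v ≡ b → adj G v u ≡ b
  adj-sym {u} {v} e = trans (sym G v u) e

  ~≁-contradiction : ∀ {u v} → u ~ v → u ≁ v → ⊥
  ~≁-contradiction u~v u≁v with () ← trans (≡-sym u~v) u≁v

  ~-irrefl : ∀ {u} → ¬ u ~ u
  ~-irrefl {u} u~u = ~≁-contradiction u~u (irrefl G u)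

  ¬≁⇒~ : ∀ {u v} → ¬ u ≁ v → u ~ v
  ¬≁⇒~ = ¬-not

  ¬~⇒≁ : ∀ {u v} → ¬ u ~ v → u ≁ v
  ¬~⇒≁ = ¬-not

NoFalseTwins : ∀ {k} → Graph k → Set
NoFalseTwins {k} H = ∀ (i j : Fin k) → i ≢ j → adj H i j ≡ true ⊎ ∃ λ l → adj H i l ≢ adj H j l

noFalseTwins? : ∀ {k} (H : Graph k) → Dec (NoFalseTwins H)
noFalseTwins? H = all? λ i → all? λ j → ¬? (i ≟ j) →-dec
  (adj H i j ≟ᵇ true ⊎-dec any? λ l → ¬? (adj H i l ≟ᵇ adj H j l))

bull-noFalseTwins : NoFalseTwins Bull
bull-noFalseTwins = from-yes (noFalseTwins? Bull)

C5-noFalseTwins : NoFalseTwins C5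
C5-noFalseTwins = from-yes (noFalseTwins? C5)

-- Two vertices of H merged by f would have equal neighbourhoods and be non-adjacent.
embedding : ∀ {k n} {H : Graph k} {G : Graph n} → NoFalseTwins H →
  (f : Fin k → Fin n) → (∀ i j → adj G (f i) (f j) ≡ adj H i j) → InducedEmbedding H G
embedding {H = H} {G} twin-free f preserves-adj = record
  { map = f ; injective = injective-f ; preserves = preserves-adj }
  where
  open Adjacency G
  injective-f : ∀ i j → f i ≡ f j → i ≡ j
  injective-f i j fi≡fj with i ≟ j
  ... | yes i≡j = i≡j
  ... | no i≢j with twin-free i j i≢j
  ...   | inj₁ i~j = ⊥-elim (~-irrefl (subst (λ x → adj G x (f j) ≡ true) fi≡fj (trans (preserves-adj i j) i~j)))
  ...   | inj₂ (l , differ) = ⊥-elim (differ (begin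
            adj H i l         ≡⟨ ≡-sym (preserves-adj i l) ⟩
            adj G (f i) (f l) ≡⟨ cong (λ x → adj G x (f l)) fi≡fj ⟩
            adj G (f j) (f l) ≡⟨ preserves-adj j l ⟩
            adj H j l         ∎))
    where open ≡-Reasoning

_∘ᵉ_ : ∀ {k m n} {H : Graph k} {K : Graph m} {G : Graph n} →
  InducedEmbedding K G → InducedEmbedding H K → InducedEmbedding H G
outer ∘ᵉ inner = record
  { map = λ i → map outer (map inner i)
  ; injective = λ i j e → injective inner i j (injective outer _ _ e)
  ; preserves = λ i j → trans (preserves outer _ _) (preserves inner i j)
  }

module FivePoint {n : ℕ} (G : Graph n) (H : Graph 5) (u : Fin 5 → Fin n) where

  Agrees : Fin 5 → Fin 5 → Set
  Agrees i j = adj G (u i) (u j) ≡ adj H i j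

  agrees-from-pairs :
    Agrees 0F 1F → Agrees 0F 2F → Agrees 0F 3F → Agrees 0F 4F → Agrees 1F 2F →
    Agrees 1F 3F → Agrees 1F 4F → Agrees 2F 3F → Agrees 2F 4F → Agrees 3F 4F →
    ∀ i j → Agrees i j
  agrees-from-pairs a01 a02 a03 a04 a12 a13 a14 a23 a24 a34 = agrees
    where
    flipped : ∀ {i j} → Agrees i j → Agrees j i
    flipped {i} {j} e = trans (sym G (u j) (u i)) (trans e (sym H i j))
    diagonal : ∀ i → Agrees i i
    diagonal i = trans (irrefl G (u i)) (≡-sym (irrefl H i))
    agrees : ∀ i j → Agrees i j
    agrees 0F 0F = diagonal 0F
    agrees 0F 1F = a01
    agrees 0F 2F = a02
    agrees 0F 3F = a03
    agrees 0F 4F = a04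
    agrees 1F 0F = flipped a01
    agrees 1F 1F = diagonal 1F
    agrees 1F 2F = a12
    agrees 1F 3F = a13
    agrees 1F 4F = a14
    agrees 2F 0F = flipped a02
    agrees 2F 1F = flipped a12
    agrees 2F 2F = diagonal 2F
    agrees 2F 3F = a23
    agrees 2F 4F = a24
    agrees 3F 0F = flipped a03
    agrees 3F 1F = flipped a13
    agrees 3F 2F = flipped a23
    agrees 3F 3F = diagonal 3F
    agrees 3F 4F = a34
    agrees 4F 0F = flipped a04
    agrees 4F 1F = flipped a14
    agrees 4F 2F = flipped a24
    agrees 4F 3F = flipped a34
    agrees 4F 4F = diagonal 4F

module Forbidden {n : ℕ} (G : Graph n) where
  open Adjacency G

  bull-at : ¬ InducedEmbedding Bull G → ∀ x y z p q →
    x ~ y → y ~ z → z ~ x → x ~ p → y ~ q →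
    x ≁ q → y ≁ p → z ≁ p → z ≁ q → p ≁ q → ⊥
  bull-at no-bull x y z p q xy yz zx xp yq xq yp zp zq pq =
    no-bull (embedding bull-noFalseTwins u (agrees-from-pairs xy (adj-sym zx) xp xq yz yp yq zp zq pq))
    where
    u : Fin 5 → Fin n
    u = lookup (x ∷ y ∷ z ∷ p ∷ q ∷ [])
    open FivePoint G Bull u

  C5-at : ¬ InducedEmbedding C5 G → ∀ x y z p q →
    x ~ y → y ~ z → z ~ p → p ~ q → q ~ x →
    x ≁ z → x ≁ p → y ≁ p → y ≁ q → z ≁ q → ⊥
  C5-at no-C5 x y z p q xy yz zp pq qx xz xp yp yq zq =
    no-C5 (embedding C5-noFalseTwins u (agrees-from-pairs xy xz xp (adj-sym qx) yz yp yq zp zq pq))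
    where
    u : Fin 5 → Fin n
    u = lookup (x ∷ y ∷ z ∷ p ∷ q ∷ [])
    open FivePoint G C5 u

module _ {n : ℕ} where

  ∉⇒∣p∣<n : ∀ {p : Subset n} {x} → x ∉ p → ∣ p ∣ < n
  ∉⇒∣p∣<n {p} {x} x∉p = subst (∣ p ∣ <_) (∣⊤∣≡n n) (p⊂q⇒∣p∣<∣q∣ ((λ _ → ∈⊤) , x , ∈⊤ , x∉p))

  ∉⇒∣p∣<∣p∪⁅x⁆∣ : ∀ {p : Subset n} {x} → x ∉ p → ∣ p ∣ < ∣ p ∪ ⁅ x ⁆ ∣
  ∉⇒∣p∣<∣p∪⁅x⁆∣ {p} {x} x∉p = p⊂q⇒∣p∣<∣q∣ (p⊆p∪q ⁅ x ⁆ , x , q⊆p∪q p ⁅ x ⁆ (x∈⁅x⁆ x) , x∉p)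

  ∈-∪⁅⁆ : ∀ {p : Subset n} {x y} → y ∈ p ∪ ⁅ x ⁆ → y ∈ p ⊎ y ≡ x
  ∈-∪⁅⁆ {p} {x} y∈ with x∈p∪q⁻ p ⁅ x ⁆ y∈
  ... | inj₁ y∈p = inj₁ y∈p
  ... | inj₂ y∈⁅x⁆ = inj₂ (x∈⁅y⁆⇒x≡y x y∈⁅x⁆)

module HomogeneousClosure {n : ℕ} (G : Graph n) (Admissible : Subset n → Set) where
  open Adjacency G

  Splits : Subset n → Fin n → Set
  Splits S v = Σ (Fin n) λ s → Σ (Fin n) λ t → s ∈ S × t ∈ S × v ~ s × v ≁ t

  splits? : ∀ S v → Dec (Splits S v)
  splits? S v = any? λ s → any? λ t → s ∈? S ×-dec t ∈? S ×-dec adj G v s ≟ᵇ true ×-dec adj G v t ≟ᵇ false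

  uniform-unless-splits : ∀ S v → ¬ Splits S v →
    (∀ x → x ∈ S → v ~ x) ⊎ (∀ x → x ∈ S → v ≁ x)
  uniform-unless-splits S v unsplit with any? (λ s → s ∈? S ×-dec adj G v s ≟ᵇ true)
  ... | yes (s , s∈S , v~s) = inj₁ λ t t∈S → ¬≁⇒~ λ v≁t → unsplit (s , t , s∈S , t∈S , v~s , v≁t)
  ... | no no-neighbour     = inj₂ λ x x∈S → ¬~⇒≁ λ v~x → no-neighbour (x , x∈S , v~x)

  module _
    (extend : ∀ {S v s t} → Admissible S → s ∈ S → t ∈ S → v ~ s → v ≁ t → Admissible (S ∪ ⁅ v ⁆))
    (outside : ∀ {S} → Admissible S → ∃ λ w → w ∉ S)
    where

    grow : ∀ (fuel : ℕ) S → Admissible S → 1 < ∣ S ∣ → n ≤ ∣ S ∣ + fuel → Σ (Subset n) (Homogeneous G)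
    grow zero S admissible _ n≤∣S∣+0 =
      ⊥-elim (<⇒≱ (∉⇒∣p∣<n (proj₂ (outside admissible))) (subst (n ≤_) (+-identityʳ ∣ S ∣) n≤∣S∣+0))
    grow (suc fuel) S admissible 1<∣S∣ n≤∣S∣+fuel
      with any? (λ v → ¬? (v ∈? S) ×-dec splits? S v)
    ... | yes (v , v∉S , s , t , s∈S , t∈S , v~s , v≁t) =
      grow fuel (S ∪ ⁅ v ⁆) (extend admissible s∈S t∈S v~s v≁t) (<-≤-trans 1<∣S∣ (<⇒≤ larger))
        (≤-trans n≤∣S∣+fuel (≤-trans (≤-reflexive (+-suc ∣ S ∣ fuel)) (+-monoˡ-≤ fuel larger)))
      where
      larger : ∣ S ∣ < ∣ S ∪ ⁅ v ⁆ ∣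
      larger = ∉⇒∣p∣<∣p∪⁅x⁆∣ v∉S
    ... | no no-splitter = S , record
      { lower = 1<∣S∣
      ; upper = ∉⇒∣p∣<n (proj₂ (outside admissible))
      ; uniform = λ v v∉S → uniform-unless-splits S v λ split → no-splitter (v , v∉S , split)
      }

    homogeneous-set : ∀ S → Admissible S → 1 < ∣ S ∣ → Σ (Subset n) (Homogeneous G)
    homogeneous-set S admissible 1<∣S∣ = grow n S admissible 1<∣S∣ (m≤n+m n ∣ S ∣)

pathe : Fin 4 → Fin 4 → Bool
pathe 0F 1F = true
pathe 1F 2F = true
pathe 2F 3F = true
pathe _  _  = false

pathloop : ∀ v → pathe v v ≡ false
pathloop 0F = refl
pathloop 1F = refl
pathloop 2F = refl
pathloop 3F = refl

P4 : Graph 4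
P4 = fromEdges pathe pathloop

module AroundInducedP4 {n : ℕ} (G : Graph n)
  (no-C5 : ¬ InducedEmbedding C5 G) (no-bull : ¬ InducedEmbedding Bull G)
  (path : InducedEmbedding P4 G) where

  open Adjacency G
  open Forbidden G

  P : Fin 4 → Fin n
  P = map path

  lift : ∀ {i j b} → adj P4 i j ≡ b → adj G (P i) (P j) ≡ b
  lift {i} {j} e = trans (preserves path i j) e

  Complete Anticomplete : Fin n → Set
  Complete v = ∀ i → v ~ P i
  Anticomplete v = ∀ i → v ≁ P i

  data MixedShape (v : Fin n) : Set where
    triangle-with-tail : ∀ i j k → adj P4 i j ≡ true → adj P4 j k ≡ true → adj P4 i k ≡ false →
      v ~ P i → v ~ P j → v ≁ P k → MixedShape v
    edge-and-far-vertex : ∀ i j k → adj P4 i j ≡ true → adj P4 i k ≡ false → adj P4 j k ≡ false →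
      v ~ P i → v ≁ P j → v ≁ P k → MixedShape v
    five-cycle : v ~ P 0F → v ≁ P 1F → v ≁ P 2F → v ~ P 3F → MixedShape v

  classify : ∀ v → Complete v ⊎ Anticomplete v ⊎ MixedShape v
  classify v with adj G v (P 0F) in e0 | adj G v (P 1F) in e1 | adj G v (P 2F) in e2 | adj G v (P 3F) in e3
  ... | true  | true  | true  | true  = inj₁ λ { 0F → e0 ; 1F → e1 ; 2F → e2 ; 3F → e3 }
  ... | false | false | false | false = inj₂ (inj₁ λ { 0F → e0 ; 1F → e1 ; 2F → e2 ; 3F → e3 })
  ... | true  | true  | true  | false = inj₂ (inj₂ (triangle-with-tail 1F 2F 3F refl refl refl e1 e2 e3))
  ... | true  | true  | false | true  = inj₂ (inj₂ (triangle-with-tail 0F 1F 2F refl refl refl e0 e1 e2))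
  ... | true  | true  | false | false = inj₂ (inj₂ (triangle-with-tail 0F 1F 2F refl refl refl e0 e1 e2))
  ... | true  | false | true  | true  = inj₂ (inj₂ (triangle-with-tail 3F 2F 1F refl refl refl e3 e2 e1))
  ... | false | true  | true  | true  = inj₂ (inj₂ (triangle-with-tail 2F 1F 0F refl refl refl e2 e1 e0))
  ... | false | true  | true  | false = inj₂ (inj₂ (triangle-with-tail 1F 2F 3F refl refl refl e1 e2 e3))
  ... | false | false | true  | true  = inj₂ (inj₂ (triangle-with-tail 3F 2F 1F refl refl refl e3 e2 e1))
  ... | true  | false | true  | false = inj₂ (inj₂ (edge-and-far-vertex 0F 1F 3F refl refl refl e0 e1 e3))
  ... | true  | false | false | false = inj₂ (inj₂ (edge-and-far-vertex 0F 1F 3F refl refl refl e0 e1 e3))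
  ... | false | true  | false | false = inj₂ (inj₂ (edge-and-far-vertex 1F 0F 3F refl refl refl e1 e0 e3))
  ... | false | false | true  | false = inj₂ (inj₂ (edge-and-far-vertex 2F 3F 0F refl refl refl e2 e3 e0))
  ... | false | true  | false | true  = inj₂ (inj₂ (edge-and-far-vertex 3F 2F 0F refl refl refl e3 e2 e0))
  ... | false | false | false | true  = inj₂ (inj₂ (edge-and-far-vertex 3F 2F 0F refl refl refl e3 e2 e0))
  ... | true  | false | false | true  = inj₂ (inj₂ (five-cycle e0 e1 e2 e3))

  separated-pair : ∀ {v} → MixedShape v → ∃₂ λ i j → v ~ P i × v ≁ P j × P i ≁ P j
  separated-pair (triangle-with-tail i j k _ _ ik vi _ vk) = i , k , vi , vk , lift ik
  separated-pair (edge-and-far-vertex i j k _ ik _ vi _ vk) = i , k , vi , vk , lift ik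
  separated-pair (five-cycle v0 _ v2 _) = 0F , 2F , v0 , v2 , lift refl

  crossing-edge : ∀ {v} → MixedShape v → ∃₂ λ i j → P i ~ P j × v ~ P i × v ≁ P j
  crossing-edge (triangle-with-tail i j k _ jk _ _ vj vk) = j , k , lift jk , vj , vk
  crossing-edge (edge-and-far-vertex i j k ij _ _ vi vj _) = i , j , lift ij , vi , vj
  crossing-edge (five-cycle v0 v1 _ _) = 0F , 1F , lift refl , v0 , v1

  neighbour-unless-anticomplete : ∀ v → Anticomplete v ⊎ ∃ λ i → v ~ P i
  neighbour-unless-anticomplete v with classify v
  ... | inj₁ complete = inj₂ (0F , complete 0F)
  ... | inj₂ (inj₁ anticomplete) = inj₁ anticomplete
  ... | inj₂ (inj₂ mixed) with crossing-edge mixed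
  ...   | i , _ , _ , vi , _ = inj₂ (i , vi)

  non-neighbour-unless-complete : ∀ v → Complete v ⊎ ∃ λ i → v ≁ P i
  non-neighbour-unless-complete v with classify v
  ... | inj₁ complete = inj₁ complete
  ... | inj₂ (inj₁ anticomplete) = inj₂ (0F , anticomplete 0F)
  ... | inj₂ (inj₂ mixed) with crossing-edge mixed
  ...   | _ , j , _ , _ , vj = inj₂ (j , vj)

  module _ {a c v : Fin n} (a∈A : Anticomplete a) (c∈C : Complete c) (mixed : MixedShape v) where

    mixed-neighbour-of-A-sees-C : v ~ a → v ~ c
    mixed-neighbour-of-A-sees-C va with adj G v c in vc
    ... | true  = refl
    ... | false = ⊥-elim (impossible mixed)
      where
      impossible : MixedShape v → ⊥
      impossible (triangle-with-tail i j k ij jk ik vi vj vk) =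
        bull-at no-bull (P j) v (P i) (P k) a (adj-sym vj) vi (lift ij) (lift jk) va
          (adj-sym (a∈A j)) vk (lift ik) (adj-sym (a∈A i)) (adj-sym (a∈A k))
      impossible (edge-and-far-vertex i j k ij ik jk vi vj vk) =
        bull-at no-bull (P i) c (P j) v (P k) (adj-sym (c∈C i)) (c∈C j) (adj-sym (lift ij)) (adj-sym vi) (c∈C k)
          (lift ik) (adj-sym vc) (adj-sym vj) (lift jk) vk
      impossible (five-cycle v0 v1 v2 v3) =
        C5-at no-C5 (P 0F) (P 1F) (P 2F) (P 3F) v (lift refl) (lift refl) (lift refl) (adj-sym v3) v0
          (lift refl) (lift refl) (lift refl) (adj-sym v1) (adj-sym v2)

    mixed-common-neighbour⇒adjacent : v ~ a → v ~ c → a ~ c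
    mixed-common-neighbour⇒adjacent va vc with adj G a c in ac
    ... | true = refl
    ... | false with separated-pair mixed
    ...   | i , j , vi , vj , ij = ⊥-elim
      (bull-at no-bull c v (P i) (P j) a (adj-sym vc) vi (adj-sym (c∈C i)) (c∈C j) va
        (adj-sym ac) vj ij (adj-sym (a∈A i)) (adj-sym (a∈A j)))

    mixed-common-non-neighbour⇒nonadjacent : v ≁ a → v ≁ c → c ≁ a
    mixed-common-non-neighbour⇒nonadjacent va vc with adj G c a in ca
    ... | false = refl
    ... | true with crossing-edge mixed
    ...   | i , j , ij , vi , vj = ⊥-elim
      (bull-at no-bull (P i) c (P j) v a (adj-sym (c∈C i)) (c∈C j) (adj-sym ij) (adj-sym vi) ca
        (adj-sym (a∈A i)) (adj-sym vc) (adj-sym vj) (adj-sym (a∈A j)) va)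

  A⁻ C⁺ : Fin n → Set
  A⁻ a = Anticomplete a × ∃ λ c → Complete c × a ≁ c
  C⁺ c = Complete c × ∃ λ a → Anticomplete a × c ~ a

  A⁻-anticomplete-to-mixed : ∀ {a v} → A⁻ a → MixedShape v → v ≁ a
  A⁻-anticomplete-to-mixed {a} {v} (a∈A , c , c∈C , a≁c) mixed with adj G v a in va
  ... | false = refl
  ... | true  = ⊥-elim (~≁-contradiction
    (mixed-common-neighbour⇒adjacent a∈A c∈C mixed va (mixed-neighbour-of-A-sees-C a∈A c∈C mixed va)) a≁c)

  C⁺-complete-to-mixed : ∀ {c v} → C⁺ c → MixedShape v → v ~ c
  C⁺-complete-to-mixed {c} {v} (c∈C , a , a∈A , c~a) mixed with adj G v c in vc
  ... | true = refl
  ... | false with adj G v a in va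
  ...   | true  = ⊥-elim (~≁-contradiction (mixed-neighbour-of-A-sees-C a∈A c∈C mixed va) vc)
  ...   | false = ⊥-elim (~≁-contradiction c~a (mixed-common-non-neighbour⇒nonadjacent a∈A c∈C mixed va vc))

  record Admissible (S : Subset n) : Set where
    field
      C⁺-complete     : ∀ {w u} → C⁺ w → u ∈ S → w ~ u
      A⁻-anticomplete : ∀ {w u} → A⁻ w → u ∈ S → w ≁ u
      A⁻-disjoint     : ∀ {u} → u ∈ S → ¬ A⁻ u
  open Admissible

  module Extension {S v s t} (admissible : Admissible S) (s∈S : s ∈ S) (t∈S : t ∈ S) (v~s : v ~ s) (v≁t : v ≁ t) where

    v-not-C⁺ : ¬ C⁺ v
    v-not-C⁺ v⁺ = ~≁-contradiction (C⁺-complete admissible v⁺ t∈S) v≁t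

    v-not-A⁻ : ¬ A⁻ v
    v-not-A⁻ v⁻ = ~≁-contradiction v~s (A⁻-anticomplete admissible v⁻ s∈S)

    C⁺-sees-anticomplete-v : ∀ {w} → C⁺ w → Anticomplete v → w ~ v
    C⁺-sees-anticomplete-v (w∈C , _) v∈A = ¬≁⇒~ λ w≁v → v-not-A⁻ (v∈A , _ , w∈C , adj-sym w≁v)

    C⁺-sees-complete-v : ∀ {w} → C⁺ w → Complete v → w ~ v
    C⁺-sees-complete-v {w} w⁺@(w∈C , a , a∈A , w~a) v∈C =
      ¬≁⇒~ λ w≁v → bull-through-t w≁v (neighbour-unless-anticomplete t)
      where
      v≁a : v ≁ a
      v≁a = ¬~⇒≁ λ v~a → v-not-C⁺ (v∈C , a , a∈A , v~a)
      a≁t : a ≁ t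
      a≁t = A⁻-anticomplete admissible (a∈A , v , v∈C , adj-sym v≁a) t∈S
      bull-through-t : w ≁ v → Anticomplete t ⊎ ∃ (λ i → t ~ P i) → ⊥
      bull-through-t _ (inj₁ t∈A) = A⁻-disjoint admissible t∈S (t∈A , v , v∈C , adj-sym v≁t)
      bull-through-t w≁v (inj₂ (i , t~Pi)) =
        bull-at no-bull w (P i) t a v (w∈C i) (adj-sym t~Pi) (adj-sym (C⁺-complete admissible w⁺ t∈S)) w~a
          (adj-sym (v∈C i)) w≁v (adj-sym (a∈A i)) (adj-sym a≁t) (adj-sym v≁t) (adj-sym v≁a)

    A⁻-misses-complete-v : ∀ {w} → A⁻ w → Complete v → w ≁ v
    A⁻-misses-complete-v (w∈A , _) v∈C = ¬~⇒≁ λ w~v → v-not-C⁺ (v∈C , _ , w∈A , adj-sym w~v)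

    A⁻-misses-anticomplete-v : ∀ {w} → A⁻ w → Anticomplete v → w ≁ v
    A⁻-misses-anticomplete-v {w} w⁻@(w∈A , c , c∈C , w≁c) v∈A =
      ¬~⇒≁ λ w~v → bull-through-s w~v (non-neighbour-unless-complete s)
      where
      v~c : v ~ c
      v~c = ¬≁⇒~ λ v≁c → v-not-A⁻ (v∈A , c , c∈C , v≁c)
      c~s : c ~ s
      c~s = C⁺-complete admissible (c∈C , v , v∈A , adj-sym v~c) s∈S
      bull-through-s : w ~ v → Complete s ⊎ ∃ (λ i → s ≁ P i) → ⊥
      bull-through-s _ (inj₁ s∈C) = ~-irrefl (C⁺-complete admissible (s∈C , v , v∈A , adj-sym v~s) s∈S)
      bull-through-s w~v (inj₂ (i , s≁Pi)) =
        bull-at no-bull v c s w (P i) v~c c~s (adj-sym v~s) (adj-sym w~v) (c∈C i)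
          (v∈A i) (adj-sym w≁c) (adj-sym (A⁻-anticomplete admissible w⁻ s∈S)) s≁Pi (w∈A i)

    C⁺-sees-v : ∀ {w} → C⁺ w → w ~ v
    C⁺-sees-v w⁺ with classify v
    ... | inj₁ v∈C          = C⁺-sees-complete-v w⁺ v∈C
    ... | inj₂ (inj₁ v∈A)   = C⁺-sees-anticomplete-v w⁺ v∈A
    ... | inj₂ (inj₂ mixed) = adj-sym (C⁺-complete-to-mixed w⁺ mixed)

    A⁻-misses-v : ∀ {w} → A⁻ w → w ≁ v
    A⁻-misses-v w⁻ with classify v
    ... | inj₁ v∈C          = A⁻-misses-complete-v w⁻ v∈C
    ... | inj₂ (inj₁ v∈A)   = A⁻-misses-anticomplete-v w⁻ v∈A
    ... | inj₂ (inj₂ mixed) = adj-sym (A⁻-anticomplete-to-mixed w⁻ mixed)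

    extended : Admissible (S ∪ ⁅ v ⁆)
    extended .C⁺-complete w⁺ u∈ with ∈-∪⁅⁆ u∈
    ... | inj₁ u∈S = C⁺-complete admissible w⁺ u∈S
    ... | inj₂ refl = C⁺-sees-v w⁺
    extended .A⁻-anticomplete w⁻ u∈ with ∈-∪⁅⁆ u∈
    ... | inj₁ u∈S = A⁻-anticomplete admissible w⁻ u∈S
    ... | inj₂ refl = A⁻-misses-v w⁻
    extended .A⁻-disjoint u∈ with ∈-∪⁅⁆ u∈
    ... | inj₁ u∈S = A⁻-disjoint admissible u∈S
    ... | inj₂ refl = v-not-A⁻

  initial : Subset n
  initial = ⁅ P 0F ⁆ ∪ ⁅ P 1F ⁆

  P0~P1 : P 0F ~ P 1F
  P0~P1 = preserves path 0F 1F

  ∈-initial : ∀ {u} → u ∈ initial → u ≡ P 0F ⊎ u ≡ P 1F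
  ∈-initial u∈ with ∈-∪⁅⁆ u∈
  ... | inj₁ u∈⁅P0⁆ = inj₁ (x∈⁅y⁆⇒x≡y (P 0F) u∈⁅P0⁆)
  ... | inj₂ u≡P1   = inj₂ u≡P1

  initial-admissible : Admissible initial
  initial-admissible .C⁺-complete (w∈C , _) u∈ with ∈-initial u∈
  ... | inj₁ refl = w∈C 0F
  ... | inj₂ refl = w∈C 1F
  initial-admissible .A⁻-anticomplete (w∈A , _) u∈ with ∈-initial u∈
  ... | inj₁ refl = w∈A 0F
  ... | inj₂ refl = w∈A 1F
  initial-admissible .A⁻-disjoint u∈ (u∈A , _) with ∈-initial u∈
  ... | inj₁ refl = ~≁-contradiction P0~P1 (u∈A 1F)
  ... | inj₂ refl = ~≁-contradiction (adj-sym P0~P1) (u∈A 0F)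

  1<∣initial∣ : 1 < ∣ initial ∣
  1<∣initial∣ = subst (_< ∣ initial ∣) (∣⁅x⁆∣≡1 (P 0F)) (∉⇒∣p∣<∣p∪⁅x⁆∣ P1∉⁅P0⁆)
    where
    P1∉⁅P0⁆ : P 1F ∉ ⁅ P 0F ⁆
    P1∉⁅P0⁆ P1∈⁅P0⁆ = ~-irrefl (subst (_~ P 1F) (≡-sym (x∈⁅y⁆⇒x≡y (P 0F) P1∈⁅P0⁆)) P0~P1)

  outside-admissible : ∀ {a c} → Anticomplete a → Complete c → ∀ {S} → Admissible S → ∃ λ w → w ∉ S
  outside-admissible {a} {c} a∈A c∈C admissible with adj G c a in ca
  ... | true  = c , λ c∈S → ~-irrefl (C⁺-complete admissible (c∈C , a , a∈A , ca) c∈S)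
  ... | false = a , λ a∈S → A⁻-disjoint admissible a∈S (a∈A , c , c∈C , adj-sym ca)

  homogeneous-set : ∀ {a c} → Anticomplete a → Complete c → Σ (Subset n) (Homogeneous G)
  homogeneous-set a∈A c∈C =
    HomogeneousClosure.homogeneous-set G Admissible
      (λ admissible s∈S t∈S v~s v≁t → Extension.extended admissible s∈S t∈S v~s v≁t)
      (outside-admissible a∈A c∈C) initial initial-admissible 1<∣initial∣

path-in-anchor : ∀ b → InducedEmbedding P4 (Anchor b)
path-in-anchor b = record
  { map = _↑ˡ 2
  ; injective = ↑ˡ-injective 2
  ; preserves = from-yes (all? λ i → all? λ j → adj (Anchor b) (i ↑ˡ 2) (j ↑ˡ 2) ≟ᵇ adj P4 i j)
  }

hub-complete : ∀ b (i : Fin 4) → adj (Anchor b) 4F (i ↑ˡ 2) ≡ true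
hub-complete b = from-yes (all? λ (i : Fin 4) → adj (Anchor b) 4F (i ↑ˡ 2) ≟ᵇ true)

isolated-anticomplete : ∀ b (i : Fin 4) → adj (Anchor b) 5F (i ↑ˡ 2) ≡ false
isolated-anticomplete b = from-yes (all? λ (i : Fin 4) → adj (Anchor b) 5F (i ↑ˡ 2) ≟ᵇ false)

homogeneous-set-from-anchor : ∀ {n} (G : Graph n) → ¬ InducedEmbedding C5 G → ¬ InducedEmbedding Bull G →
  ∀ b → InducedEmbedding (Anchor b) G → Σ (Subset n) (Homogeneous G)
homogeneous-set-from-anchor G no-C5 no-bull b anchor = homogeneous-set
  (λ i → trans (preserves anchor 5F (i ↑ˡ 2)) (isolated-anticomplete b i))
  (λ i → trans (preserves anchor 4F (i ↑ˡ 2)) (hub-complete b i))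
  where open AroundInducedP4 G no-C5 no-bull (anchor ∘ᵉ path-in-anchor b)

theorem1p4 : {n : ℕ} (G : Graph n) →
    ¬ InducedEmbedding C5 G → ¬ InducedEmbedding Bull G →
    ContainsAnchor G → Σ (Subset n) (λ X → Homogeneous G X)
theorem1p4 G no-C5 no-bull (inj₁ anchor) = homogeneous-set-from-anchor G no-C5 no-bull true anchor
theorem1p4 G no-C5 no-bull (inj₂ anchor) = homogeneous-set-from-anchor G no-C5 no-bull false anchor
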